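{- Let $n\ge2$, $\boldsymbol a\in\{0,1\}^{n-1}$, $\vec\sigma\in\{0,1\}^n$, and let $\mu_{\boldsymbol j,\boldsymbol m}$ be the Haar coefficients of $\Delta(\cdot,\mathcal{P}_{\boldsymbol a}(\vec\sigma))$. Then for $\boldsymbol j=(-1,n-1)$, $$2^{n-1}\sum_{m_2=0}^{2^{n-1}-1}|\mu_{\boldsymbol j,(0,m_2)}|^2=\frac13\,2^{ -4n-4}\bigl(2^{2n}-3\cdot2^n+2+3\sigma_n2^{n+1}\bigr).$$
   Context: $\oplus$ denotes addition modulo 2. For an integer $n\ge1$, $\boldsymbol{a}=(a_1,\dots,a_{n-1})\in\{0,1\}^{n-1}$ and $\vec{\sigma}=(\sigma_1,\dots,\sigma_n)\in\{0,1\}^n$, let $\mathcal{P}_{\boldsymbol{a}}(\vec{\sigma})\subset[0,1)^2$ be the set of the $2^n$ points $\bigl(\frac{t_n}{2}+\dots+\frac{t_1}{2^n},\ \frac{b_1}{2}+\dots+\frac{b_n}{2^n}\bigr)$, $(t_1,\dots,t_n)\in\{0,1\}^n$, with $b_k=t_k\oplus a_kt_n\oplus\sigma_k$ for $1\le k\le n-1$ and $b_n=t_n\oplus\sigma_n$. For an $N$-point set $\mathcal{P}$ the discrepancy function is $\Delta(\boldsymbol{t},\mathcal{P})=\frac1N\#\{\boldsymbol{z}\in\mathcal{P}:\boldsymbol{z}\in[0,t_1)\times[0,t_2)\}-t_1t_2$. Haar functions: for $j\ge0$, $m\in\{0,\dots,2^j-1\}$, $h_{j,m}$ is $+1$ on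 $[m2^{ -j},(m+\frac12)2^{ -j})$, $-1$ on $[(m+\frac12)2^{ -j},(m+1)2^{ -j})$ and $0$ elsewhere on $[0,1)$; $h_{ -1,0}=\mathbf 1_{[0,1)}$. For $\boldsymbol j=(j_1,j_2)$, $\boldsymbol m=(m_1,m_2)$, $h_{\boldsymbol j,\boldsymbol m}(\boldsymbol t)=h_{j_1,m_1}(t_1)h_{j_2,m_2}(t_2)$ and $\mu_{\boldsymbol j,\boldsymbol m}=\int_{[0,1)^2}\Delta(\boldsymbol t,\mathcal P)h_{\boldsymbol j,\boldsymbol m}(\boldsymbol t)\,d\boldsymbol t$. -}

module Defs where

open import Data.Nat as ℕ using (ℕ; zero; suc; _≤ᵇ_; _∸_; _⊔_)
open import Data.Bool using (Bool; true; false; _xor_; _∧_; if_then_else_)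
open import Data.Fin using (Fin; zero; suc; toℕ; fromℕ)
open import Data.List using (List; []; _∷_; map; _++_; length; filter; upTo; concatMap)
open import Data.Nat.ListAction using (sum)
open import Data.Integer using (+_)
open import Data.Rational using (ℚ; 0ℚ; 1ℚ; ½; _+_; _*_; _-_)
open import Data.Nat.Properties using (m^n≢0)
open import Data.Nat.DivMod as DM using ()

pow2 : ℕ → ℚ
pow2 zero    = 1ℚ
pow2 (suc k) = (+ 2 / 1) * pow2 k
  where open import Data.Rational using (_/_)

pow2ℕ : ℕ → ℕ
pow2ℕ k = 2 ℕ.^ k

third : ℚ
third = (+ 1) / 3
  where open import Data.Rational using (_/_)

ipow2 : ℕ → ℚ
ipow2 zero    = 1ℚ
ipow2 (suc k) = ½ * ipow2 k

ℕtoℚ : ℕ → ℚ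
ℕtoℚ k = (+ k) / 1
  where open import Data.Rational using (_/_)

bit : Bool → ℕ
bit true  = 1
bit false = 0

Σℚ : {A : Set} → List A → (A → ℚ) → ℚ
Σℚ xs f = Data.List.foldr (λ x acc → f x + acc) 0ℚ xs
  where import Data.List

Σℕ : {A : Set} → List A → (A → ℕ) → ℕ
Σℕ xs f = sum (map f xs)

allBits : (n : ℕ) → List (Fin n → Bool)
allBits zero    = (λ ()) ∷ []
allBits (suc n) = concatMap (λ v → cons false v ∷ cons true v ∷ []) (allBits n)
  where
    cons : Bool → (Fin n → Bool) → Fin (suc n) → Bool
    cons b v zero    = b
    cons b v (suc i) = v i

-- The point set P_a(σ).  Index i : Fin n stands for the paper's index
-- k = toℕ i + 1.

-- last coordinate x_n of a vector in {0,1}^n (n ≥ 1; junk for n = 0)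
lastBit : {n : ℕ} → (Fin n → Bool) → Bool
lastBit {zero}  v = false
lastBit {suc m} v = v (fromℕ m)

-- extend a ∈ {0,1}^{n-1} by a_n := 0 (the a_k t_n term is absent for k = n)
aExt : {n : ℕ} → (Fin (n ∸ 1) → Bool) → Fin n → Bool
aExt {suc zero}    a zero    = false
aExt {suc (suc q)} a zero    = a zero
aExt {suc (suc q)} a (suc i) = aExt {suc q} (λ k → a (suc k)) i

bDigits : {n : ℕ} → (Fin (n ∸ 1) → Bool) → (Fin n → Bool) → (Fin n → Bool) → Fin n → Bool
bDigits a σ t k = (t k xor (aExt a k ∧ lastBit t)) xor σ k

-- numerators (over 2^n) of the coordinates of the point indexed by t:
-- x = t_n/2 + ... + t_1/2^n  ↦  X = Σ_k t_k 2^{k-1}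
-- y = b_1/2 + ... + b_n/2^n  ↦  Y = Σ_k b_k 2^{n-k}
allFinL : (n : ℕ) → List (Fin n)
allFinL zero    = []
allFinL (suc n) = zero ∷ map suc (allFinL n)

pointX : (n : ℕ) → (Fin n → Bool) → ℕ
pointX n t = Σℕ (allFinL n) (λ k → bit (t k) ℕ.* (2 ℕ.^ toℕ k))

pointY : (n : ℕ) → (Fin (n ∸ 1) → Bool) → (Fin n → Bool) → (Fin n → Bool) → ℕ
pointY n a σ t = Σℕ (allFinL n) (λ k → bit (bDigits a σ t k) ℕ.* (2 ℕ.^ (n ∸ suc (toℕ k))))

-- Haar functions.  Level -1 is `lvm1`, level j ≥ 0 is `lvl j`.

data Level : Set where
  lvm1 : Level
  lvl  : ℕ → Level

-- every Haar function of level j is constant on dyadic cells of level ≥ depth j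
depth : Level → ℕ
depth lvm1    = 0
depth (lvl j) = suc j

-- value of h_{j,m} on the dyadic cell [i 2^{-L}, (i+1) 2^{-L}), for L ≥ depth j
haarCell : Level → ℕ → (L i : ℕ) → ℚ
haarCell lvm1    m L i = 1ℚ
haarCell (lvl j) m L i =
  if q ℕ.≡ᵇ (2 ℕ.* m) then 1ℚ
  else if q ℕ.≡ᵇ suc (2 ℕ.* m) then (0ℚ - 1ℚ) else 0ℚ
  where
    nz : ℕ.NonZero (2 ℕ.^ (L ∸ suc j))
    nz = m^n≢0 2 (L ∸ suc j)
    q : ℕ
    q = ℕ._/_ i (2 ℕ.^ (L ∸ suc j)) {{nz}}

-- Exact integration.  A bilinear polynomial c00 + c10 t1 + c01 t2 + c11 t1 t2
-- is integrated exactly over a square [x0, x0+d) × [y0, y0+d).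

record Bilin : Set where
  constructor bilin
  field c00 c10 c01 c11 : ℚ

∫square : Bilin → (x0 y0 d : ℚ) → ℚ
∫square (bilin c00 c10 c01 c11) x0 y0 d =
  let I1 = d                          -- ∫_{x0}^{x0+d} 1
      It = x0 * d + ½ * (d * d)       -- ∫_{x0}^{x0+d} t
      Is = y0 * d + ½ * (d * d)       -- ∫_{y0}^{y0+d} s
  in c00 * (I1 * I1) + c10 * (It * I1) + c01 * (I1 * Is) + c11 * (It * Is)

-- Discrepancy function Δ(t, P_a(σ)) = (1/N) #{z ∈ P : z ∈ [0,t1)×[0,t2)} - t1 t2,
-- N = 2^n.  On the interior of the level-L dyadic cell (i1,i2), L ≥ n, the
-- counting term is constant: z1 = X/2^n < t1 for all interior t1 iff
-- X 2^{L-n} ≤ i1 (same for the second coordinate), so Δ restricted to the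
-- cell is the bilinear polynomial  count/N - t1 t2.

countCell : (n : ℕ) → (Fin (n ∸ 1) → Bool) → (Fin n → Bool) → (L i1 i2 : ℕ) → ℕ
countCell n a σ L i1 i2 =
  length (filter (λ t → (pointX n t ℕ.* 2 ℕ.^ (L ∸ n)) ℕ.≤? i1)
                 (filter (λ t → (pointY n a σ t ℕ.* 2 ℕ.^ (L ∸ n)) ℕ.≤? i2) (allBits n)))

ΔCell : (n : ℕ) → (Fin (n ∸ 1) → Bool) → (Fin n → Bool) → (L i1 i2 : ℕ) → Bilin
ΔCell n a σ L i1 i2 = bilin (ℕtoℚ (countCell n a σ L i1 i2) * ipow2 n) 0ℚ 0ℚ (0ℚ - 1ℚ)

-- grid level on which both Δ and h_{j,m} are cellwise polynomial
gridLevel : ℕ → Level → Level → ℕ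
gridLevel n j1 j2 = n ⊔ depth j1 ⊔ depth j2

-- Haar coefficient μ_{j,m} = ∫_{[0,1)^2} Δ(t, P_a(σ)) h_{j,m}(t) dt,
-- computed exactly as the sum over the cells of the level-L dyadic grid.
μ : (n : ℕ) → (Fin (n ∸ 1) → Bool) → (Fin n → Bool) →
    (j1 j2 : Level) → (m1 m2 : ℕ) → ℚ
μ n a σ j1 j2 m1 m2 =
  let L = gridLevel n j1 j2
      d = ipow2 L
  in Σℚ (upTo (2 ℕ.^ L)) λ i1 → Σℚ (upTo (2 ℕ.^ L)) λ i2 →
       haarCell j1 m1 L i1 * haarCell j2 m2 L i2 *
       ∫square (ΔCell n a σ L i1 i2) (ℕtoℚ i1 * d) (ℕtoℚ i2 * d) d

{-# OPTIONS --safe #-}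

-- On the dyadic grid of mesh 2⁻ⁿ the discrepancy function is bilinear on every cell, and
-- h_{n-1,m} is +1 on row 2m and -1 on row 2m+1, so μ_{(-1,n-1),(0,m)} is a finite sum of
-- row differences.  These only see the points of P with y-numerator 2m+1, and since the
-- y-coordinates of P run through the grid exactly once there is a single such point; if x
-- is its x-numerator, μ = 2⁻³ⁿ (x - 2ⁿ⁻¹).  The y-numerator is odd iff t_n ≠ σ_n, while
-- x ≥ 2ⁿ⁻¹ iff t_n = 1, and x also runs through [0, 2ⁿ) exactly once.  So the sum of the
-- squares is 2⁻⁶ⁿ Σ_{i<2ⁿ⁻¹} (i - σ_n 2ⁿ⁻¹)², a sum of consecutive squares.

module Submission where

open import Defs
open import Data.Bool using (Bool; true; false; not; _xor_; _∧_; if_then_else_)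
open import Data.Fin using (Fin; zero; suc; toℕ)
open import Data.List using (List; []; _∷_; _++_; _∷ʳ_; filter; length; upTo; concatMap)
import Data.List.Properties as Listₚ
open import Data.Nat using (ℕ; zero; suc; _≤_; _<_; _∸_; _^_; _≡ᵇ_; _≤ᵇ_; _≟_; _≤?_; z≤n; s≤s)
  renaming (_+_ to _+ℕ_; _*_ to _*ℕ_)
import Data.Nat.Properties as ℕₚ
open import Data.Nat.ListAction using (sum)
open import Data.Nat.DivMod using (n/1≡n) renaming (_/_ to _div_)
open import Data.Nat.Tactic.RingSolver using (solve-∀)
import Data.Nat.Coprimality as Coprime
import Data.Integer as ℤ
import Data.Integer.Properties as ℤₚ
open import Data.Rational using (ℚ; mkℚ; ↥_; _/_; 0ℚ; 1ℚ; ½; _+_; _*_; _-_; -_; ∣_∣)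
import Data.Rational.Properties as ℚₚ
open import Data.Rational.Solver using (module +-*-Solver)
open +-*-Solver
open import Data.Product using (Σ; _,_)
open import Data.Sum using (inj₁; inj₂)
open import Function using (id)
open import Relation.Nullary using (Dec; yes; no; does; ¬_)
open import Relation.Nullary.Decidable using (dec-true; dec-false)
open import Relation.Unary using (Pred; Decidable)
open import Relation.Binary.Definitions using (tri<; tri≈; tri>)
open import Relation.Binary.PropositionalEquality
open ≡-Reasoning

𝟙 : Bool → ℚ
𝟙 true  = 1ℚ
𝟙 false = 0ℚ

ℕtoℚ≡mkℚ : ∀ k → ℕtoℚ k ≡ mkℚ (ℤ.+ k) 0 (Coprime.sym (Coprime.1-coprimeTo k))
ℕtoℚ≡mkℚ k = ℚₚ.normalize-coprime (Coprime.sym (Coprime.1-coprimeTo k))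

ℕtoℚ-injective : ∀ {j k} → ℕtoℚ j ≡ ℕtoℚ k → j ≡ k
ℕtoℚ-injective {j} {k} eq =
  ℤₚ.+-injective (trans (cong ↥_ (sym (ℕtoℚ≡mkℚ j))) (trans (cong ↥_ eq) (cong ↥_ (ℕtoℚ≡mkℚ k))))

ℕtoℚ-suc : ∀ k → ℕtoℚ (suc k) ≡ 1ℚ + ℕtoℚ k
ℕtoℚ-suc k = begin
  (ℤ.+ suc k) / 1                                    ≡⟨ ℚₚ./-cong (cong (λ z → ℤ.1ℤ ℤ.+ z) (sym (ℤₚ.*-identityʳ (ℤ.+ k)))) refl ⟩
  (ℤ.1ℤ ℤ.* ℤ.1ℤ ℤ.+ (ℤ.+ k) ℤ.* ℤ.1ℤ) / 1         ≡⟨⟩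
  1ℚ + mkℚ (ℤ.+ k) 0 (Coprime.sym (Coprime.1-coprimeTo k)) ≡⟨ cong (1ℚ +_) (sym (ℕtoℚ≡mkℚ k)) ⟩
  1ℚ + ℕtoℚ k                                      ∎

ℕtoℚ-+ : ∀ j k → ℕtoℚ (j +ℕ k) ≡ ℕtoℚ j + ℕtoℚ k
ℕtoℚ-+ zero    k = sym (ℚₚ.+-identityˡ (ℕtoℚ k))
ℕtoℚ-+ (suc j) k = begin
  ℕtoℚ (suc (j +ℕ k))        ≡⟨ ℕtoℚ-suc (j +ℕ k) ⟩
  1ℚ + ℕtoℚ (j +ℕ k)         ≡⟨ cong (1ℚ +_) (ℕtoℚ-+ j k) ⟩
  1ℚ + (ℕtoℚ j + ℕtoℚ k)     ≡⟨ sym (ℚₚ.+-assoc 1ℚ (ℕtoℚ j) (ℕtoℚ k)) ⟩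
  (1ℚ + ℕtoℚ j) + ℕtoℚ k     ≡⟨ cong (_+ ℕtoℚ k) (sym (ℕtoℚ-suc j)) ⟩
  ℕtoℚ (suc j) + ℕtoℚ k      ∎

ℕtoℚ-* : ∀ j k → ℕtoℚ (j *ℕ k) ≡ ℕtoℚ j * ℕtoℚ k
ℕtoℚ-* zero    k = sym (ℚₚ.*-zeroˡ (ℕtoℚ k))
ℕtoℚ-* (suc j) k = begin
  ℕtoℚ (k +ℕ j *ℕ k)         ≡⟨ ℕtoℚ-+ k (j *ℕ k) ⟩
  ℕtoℚ k + ℕtoℚ (j *ℕ k)     ≡⟨ cong (ℕtoℚ k +_) (ℕtoℚ-* j k) ⟩
  ℕtoℚ k + ℕtoℚ j * ℕtoℚ k   ≡⟨ solve 2 (λ x y → y :+ x :* y := (con 1ℚ :+ x) :* y) refl (ℕtoℚ j) (ℕtoℚ k) ⟩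
  (1ℚ + ℕtoℚ j) * ℕtoℚ k     ≡⟨ cong (_* ℕtoℚ k) (sym (ℕtoℚ-suc j)) ⟩
  ℕtoℚ (suc j) * ℕtoℚ k      ∎

pow2≡ℕtoℚ : ∀ k → pow2 k ≡ ℕtoℚ (2 ^ k)
pow2≡ℕtoℚ zero    = refl
pow2≡ℕtoℚ (suc k) = trans (cong (ℕtoℚ 2 *_) (pow2≡ℕtoℚ k)) (sym (ℕtoℚ-* 2 (2 ^ k)))

pow2-+ : ∀ j k → pow2 (j +ℕ k) ≡ pow2 j * pow2 k
pow2-+ zero    k = sym (ℚₚ.*-identityˡ (pow2 k))
pow2-+ (suc j) k = trans (cong (ℕtoℚ 2 *_) (pow2-+ j k)) (sym (ℚₚ.*-assoc (ℕtoℚ 2) (pow2 j) (pow2 k)))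

ipow2-+ : ∀ j k → ipow2 (j +ℕ k) ≡ ipow2 j * ipow2 k
ipow2-+ zero    k = sym (ℚₚ.*-identityˡ (ipow2 k))
ipow2-+ (suc j) k = trans (cong (½ *_) (ipow2-+ j k)) (sym (ℚₚ.*-assoc ½ (ipow2 j) (ipow2 k)))

ipow2*pow2 : ∀ k → ipow2 k * pow2 k ≡ 1ℚ
ipow2*pow2 zero    = refl
ipow2*pow2 (suc k) = begin
  (½ * ipow2 k) * (ℕtoℚ 2 * pow2 k) ≡⟨ solve 2 (λ e p → (con ½ :* e) :* (con (ℕtoℚ 2) :* p) := e :* p) refl (ipow2 k) (pow2 k) ⟩
  ipow2 k * pow2 k                  ≡⟨ ipow2*pow2 k ⟩
  1ℚ                                ∎

∣p∣*∣p∣≡p*p : ∀ p → ∣ p ∣ * ∣ p ∣ ≡ p * p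
∣p∣*∣p∣≡p*p p with ℚₚ.∣p∣≡p∨∣p∣≡-p p
... | inj₁ ∣p∣≡p  = cong (λ q → q * q) ∣p∣≡p
... | inj₂ ∣p∣≡-p = trans (cong (λ q → q * q) ∣p∣≡-p) (solve 1 (λ x → (:- x) :* (:- x) := x :* x) refl p)

-- does (i ≟ j) and does (i ≤? j) reduce to i ≡ᵇ j and i ≤ᵇ j.
≡ᵇ-true : ∀ {i j} → i ≡ j → (i ≡ᵇ j) ≡ true
≡ᵇ-true {i} {j} = dec-true (i ≟ j)

≡ᵇ-false : ∀ {i j} → i ≢ j → (i ≡ᵇ j) ≡ false
≡ᵇ-false {i} {j} = dec-false (i ≟ j)

≤ᵇ-true : ∀ {i j} → i ≤ j → (i ≤ᵇ j) ≡ true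
≤ᵇ-true {i} {j} = dec-true (i ≤? j)

≤ᵇ-false : ∀ {i j} → ¬ i ≤ j → (i ≤ᵇ j) ≡ false
≤ᵇ-false {i} {j} = dec-false (i ≤? j)

does-⇔ : {A B : Set} (A? : Dec A) (B? : Dec B) → (A → B) → (B → A) → does A? ≡ does B?
does-⇔ (yes a) B? A→B B→A = sym (dec-true B? (A→B a))
does-⇔ (no ¬a) B? A→B B→A = sym (dec-false B? (λ b → ¬a (B→A b)))

≤ᵇ-double : ∀ b {M x} → (M ≤ᵇ x) ≡ (2 *ℕ M ≤ᵇ bit b +ℕ 2 *ℕ x)
≤ᵇ-double b {M} {x} = does-⇔ (M ≤? x) (2 *ℕ M ≤? bit b +ℕ 2 *ℕ x)
  (λ M≤x → ℕₚ.≤-trans (ℕₚ.*-monoʳ-≤ 2 M≤x) (ℕₚ.m≤n+m (2 *ℕ x) (bit b)))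
  (halve b)
  where
  halve : ∀ b → 2 *ℕ M ≤ bit b +ℕ 2 *ℕ x → M ≤ x
  halve false 2M≤2x   = ℕₚ.*-cancelˡ-≤ 2 2M≤2x
  halve true  2M≤1+2x = ℕₚ.*-cancelˡ-≤ 2 (ℕₚ.≤-pred (ℕₚ.≤∧≢⇒< 2M≤1+2x (ℕₚ.even≢odd M x)))

𝟙-≤ᵇ-step : ∀ z y → 𝟙 (z ≤ᵇ y) - 𝟙 (z ≤ᵇ suc y) ≡ - 𝟙 (z ≡ᵇ suc y)
𝟙-≤ᵇ-step z y with ℕₚ.<-cmp z (suc y)
... | tri< z<1+y _ _
  rewrite ≤ᵇ-true (ℕₚ.≤-pred z<1+y) | ≤ᵇ-true (ℕₚ.<⇒≤ z<1+y) | ≡ᵇ-false (ℕₚ.<⇒≢ z<1+y) = refl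
... | tri≈ _ refl _
  rewrite ≤ᵇ-false (ℕₚ.<⇒≱ (ℕₚ.n<1+n y)) | ≤ᵇ-true (ℕₚ.≤-refl {suc y}) | ≡ᵇ-true (refl {x = suc y}) = refl
... | tri> _ _ 1+y<z
  rewrite ≤ᵇ-false (ℕₚ.<⇒≱ (ℕₚ.<-trans (ℕₚ.n<1+n y) 1+y<z)) | ≤ᵇ-false (ℕₚ.<⇒≱ 1+y<z) | ≡ᵇ-false (ℕₚ.>⇒≢ 1+y<z) = refl

if-haar : ∀ i p → (if i ≡ᵇ p then 1ℚ else if i ≡ᵇ suc p then 0ℚ - 1ℚ else 0ℚ) ≡ 𝟙 (i ≡ᵇ p) - 𝟙 (i ≡ᵇ suc p)
if-haar i p with i ≟ p
... | yes refl rewrite ≡ᵇ-true (refl {x = i}) | ≡ᵇ-false (ℕₚ.<⇒≢ (ℕₚ.n<1+n i)) = refl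
... | no i≢p rewrite ≡ᵇ-false i≢p with i ≡ᵇ suc p
...   | true  = refl
...   | false = refl

xor-pair : ∀ c (g : Bool → ℚ) → g (false xor c) + g (true xor c) ≡ g false + g true
xor-pair false g = refl
xor-pair true  g = ℚₚ.+-comm (g true) (g false)

bit≤1 : ∀ b → bit b ≤ 1
bit≤1 false = z≤n
bit≤1 true  = s≤s z≤n

module _ {A : Set} where

  Σ-cong : (xs : List A) {f g : A → ℚ} → (∀ x → f x ≡ g x) → Σℚ xs f ≡ Σℚ xs g
  Σ-cong []       f≗g = refl
  Σ-cong (x ∷ xs) f≗g = cong₂ _+_ (f≗g x) (Σ-cong xs f≗g)

  Σ-0 : (xs : List A) → Σℚ xs (λ _ → 0ℚ) ≡ 0ℚ
  Σ-0 []       = refl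
  Σ-0 (x ∷ xs) = trans (ℚₚ.+-identityˡ _) (Σ-0 xs)

  Σ-+ : (xs : List A) (f g : A → ℚ) → Σℚ xs (λ x → f x + g x) ≡ Σℚ xs f + Σℚ xs g
  Σ-+ []       f g = refl
  Σ-+ (x ∷ xs) f g = trans (cong (f x + g x +_) (Σ-+ xs f g))
    (solve 4 (λ a b c d → (a :+ b) :+ (c :+ d) := (a :+ c) :+ (b :+ d)) refl (f x) (g x) _ _)

  Σ-*ˡ : (xs : List A) (c : ℚ) (f : A → ℚ) → Σℚ xs (λ x → c * f x) ≡ c * Σℚ xs f
  Σ-*ˡ []       c f = sym (ℚₚ.*-zeroʳ c)
  Σ-*ˡ (x ∷ xs) c f = trans (cong (c * f x +_) (Σ-*ˡ xs c f)) (sym (ℚₚ.*-distribˡ-+ c (f x) _))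

  Σ-neg : (xs : List A) (f : A → ℚ) → Σℚ xs (λ x → - f x) ≡ - Σℚ xs f
  Σ-neg []       f = refl
  Σ-neg (x ∷ xs) f = trans (cong (- f x +_) (Σ-neg xs f)) (sym (ℚₚ.neg-distrib-+ (f x) _))

  Σ-minus : (xs : List A) (f g : A → ℚ) → Σℚ xs (λ x → f x - g x) ≡ Σℚ xs f - Σℚ xs g
  Σ-minus xs f g = trans (Σ-+ xs f (λ x → - g x)) (cong (Σℚ xs f +_) (Σ-neg xs g))

  Σ-++ : (xs ys : List A) (f : A → ℚ) → Σℚ (xs ++ ys) f ≡ Σℚ xs f + Σℚ ys f
  Σ-++ []       ys f = sym (ℚₚ.+-identityˡ _)
  Σ-++ (x ∷ xs) ys f = trans (cong (f x +_) (Σ-++ xs ys f)) (sym (ℚₚ.+-assoc (f x) _ _))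

  Σ-concatMap-pair : {B : Set} (xs : List B) (g h : B → A) (f : A → ℚ) →
    Σℚ (concatMap (λ x → g x ∷ h x ∷ []) xs) f ≡ Σℚ xs (λ x → f (g x) + f (h x))
  Σ-concatMap-pair []       g h f = refl
  Σ-concatMap-pair (x ∷ xs) g h f =
    trans (cong (λ s → f (g x) + (f (h x) + s)) (Σ-concatMap-pair xs g h f)) (sym (ℚₚ.+-assoc (f (g x)) _ _))

  Σ-filter : ∀ {ℓ} {P : Pred A ℓ} (P? : Decidable P) (xs : List A) (f : A → ℚ) →
    Σℚ (filter P? xs) f ≡ Σℚ xs (λ x → 𝟙 (does (P? x)) * f x)
  Σ-filter P? []       f = refl
  Σ-filter P? (x ∷ xs) f with does (P? x)
  ... | true  = cong₂ _+_ (sym (ℚₚ.*-identityˡ (f x))) (Σ-filter P? xs f)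
  ... | false = trans (Σ-filter P? xs f) (sym (trans (cong (_+ _) (ℚₚ.*-zeroˡ (f x))) (ℚₚ.+-identityˡ _)))

  ℕtoℚ-length : (xs : List A) → ℕtoℚ (length xs) ≡ Σℚ xs (λ _ → 1ℚ)
  ℕtoℚ-length []       = refl
  ℕtoℚ-length (x ∷ xs) = trans (ℕtoℚ-suc (length xs)) (cong (1ℚ +_) (ℕtoℚ-length xs))

  ℕtoℚ-length-filter : ∀ {ℓ} {P : Pred A ℓ} (P? : Decidable P) (xs : List A) →
    ℕtoℚ (length (filter P? xs)) ≡ Σℚ xs (λ x → 𝟙 (does (P? x)))
  ℕtoℚ-length-filter P? xs = begin
    ℕtoℚ (length (filter P? xs))           ≡⟨ ℕtoℚ-length (filter P? xs) ⟩
    Σℚ (filter P? xs) (λ _ → 1ℚ)           ≡⟨ Σ-filter P? xs (λ _ → 1ℚ) ⟩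
    Σℚ xs (λ x → 𝟙 (does (P? x)) * 1ℚ)     ≡⟨ Σ-cong xs (λ x → ℚₚ.*-identityʳ (𝟙 (does (P? x)))) ⟩
    Σℚ xs (λ x → 𝟙 (does (P? x)))          ∎

Σ-swap : {A B : Set} (xs : List A) (ys : List B) (f : A → B → ℚ) →
  Σℚ xs (λ x → Σℚ ys (f x)) ≡ Σℚ ys (λ y → Σℚ xs (λ x → f x y))
Σ-swap []       ys f = sym (Σ-0 ys)
Σ-swap (x ∷ xs) ys f =
  trans (cong (Σℚ ys (f x) +_) (Σ-swap xs ys f)) (sym (Σ-+ ys (f x) (λ y → Σℚ xs (λ x′ → f x′ y))))

Σ-*ʳ : {A : Set} (xs : List A) (f : A → ℚ) (c : ℚ) → Σℚ xs (λ x → f x * c) ≡ Σℚ xs f * c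
Σ-*ʳ xs f c = begin
  Σℚ xs (λ x → f x * c) ≡⟨ Σ-cong xs (λ x → ℚₚ.*-comm (f x) c) ⟩
  Σℚ xs (λ x → c * f x) ≡⟨ Σ-*ˡ xs c f ⟩
  c * Σℚ xs f           ≡⟨ ℚₚ.*-comm c (Σℚ xs f) ⟩
  Σℚ xs f * c           ∎

Σ-upTo-suc : ∀ n (f : ℕ → ℚ) → Σℚ (upTo (suc n)) f ≡ Σℚ (upTo n) f + f n
Σ-upTo-suc n f = begin
  Σℚ (upTo (suc n)) f         ≡⟨ cong (λ xs → Σℚ xs f) (sym (Listₚ.applyUpTo-∷ʳ id n)) ⟩
  Σℚ (upTo n ∷ʳ n) f          ≡⟨ Σ-++ (upTo n) (n ∷ []) f ⟩
  Σℚ (upTo n) f + (f n + 0ℚ)  ≡⟨ cong (Σℚ (upTo n) f +_) (ℚₚ.+-identityʳ (f n)) ⟩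
  Σℚ (upTo n) f + f n         ∎

Σ-upTo-cong : ∀ n {f g : ℕ → ℚ} → (∀ i → i < n → f i ≡ g i) → Σℚ (upTo n) f ≡ Σℚ (upTo n) g
Σ-upTo-cong zero    f≗g = refl
Σ-upTo-cong (suc n) {f} {g} f≗g = begin
  Σℚ (upTo (suc n)) f  ≡⟨ Σ-upTo-suc n f ⟩
  Σℚ (upTo n) f + f n  ≡⟨ cong₂ _+_ (Σ-upTo-cong n (λ i i<n → f≗g i (ℕₚ.m<n⇒m<1+n i<n))) (f≗g n ℕₚ.≤-refl) ⟩
  Σℚ (upTo n) g + g n  ≡⟨ sym (Σ-upTo-suc n g) ⟩
  Σℚ (upTo (suc n)) g  ∎

Σ-upTo-+ : ∀ m n (f : ℕ → ℚ) → Σℚ (upTo (m +ℕ n)) f ≡ Σℚ (upTo m) f + Σℚ (upTo n) (λ i → f (m +ℕ i))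
Σ-upTo-+ m zero    f = trans (cong (λ k → Σℚ (upTo k) f) (ℕₚ.+-identityʳ m)) (sym (ℚₚ.+-identityʳ _))
Σ-upTo-+ m (suc n) f = begin
  Σℚ (upTo (m +ℕ suc n)) f               ≡⟨ cong (λ k → Σℚ (upTo k) f) (ℕₚ.+-suc m n) ⟩
  Σℚ (upTo (suc (m +ℕ n))) f             ≡⟨ Σ-upTo-suc (m +ℕ n) f ⟩
  Σℚ (upTo (m +ℕ n)) f + g n             ≡⟨ cong (_+ g n) (Σ-upTo-+ m n f) ⟩
  (Σℚ (upTo m) f + Σℚ (upTo n) g) + g n  ≡⟨ ℚₚ.+-assoc (Σℚ (upTo m) f) _ _ ⟩
  Σℚ (upTo m) f + (Σℚ (upTo n) g + g n)  ≡⟨ cong (Σℚ (upTo m) f +_) (sym (Σ-upTo-suc n g)) ⟩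
  Σℚ (upTo m) f + Σℚ (upTo (suc n)) g    ∎
  where
  g : ℕ → ℚ
  g i = f (m +ℕ i)

Σ-upTo-2* : ∀ n (f : ℕ → ℚ) → Σℚ (upTo (2 *ℕ n)) f ≡ Σℚ (upTo n) (λ i → f (2 *ℕ i) + f (suc (2 *ℕ i)))
Σ-upTo-2* zero    f = refl
Σ-upTo-2* (suc n) f = begin
  Σℚ (upTo (2 *ℕ suc n)) f                                 ≡⟨ cong (λ k → Σℚ (upTo k) f) (ℕₚ.*-suc 2 n) ⟩
  Σℚ (upTo (suc (suc (2 *ℕ n)))) f                         ≡⟨ Σ-upTo-suc (suc (2 *ℕ n)) f ⟩
  Σℚ (upTo (suc (2 *ℕ n))) f + f (suc (2 *ℕ n))            ≡⟨ cong (_+ f (suc (2 *ℕ n))) (Σ-upTo-suc (2 *ℕ n) f) ⟩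
  (Σℚ (upTo (2 *ℕ n)) f + f (2 *ℕ n)) + f (suc (2 *ℕ n))   ≡⟨ ℚₚ.+-assoc (Σℚ (upTo (2 *ℕ n)) f) _ _ ⟩
  Σℚ (upTo (2 *ℕ n)) f + g n                               ≡⟨ cong (_+ g n) (Σ-upTo-2* n f) ⟩
  Σℚ (upTo n) g + g n                                      ≡⟨ sym (Σ-upTo-suc n g) ⟩
  Σℚ (upTo (suc n)) g                                      ∎
  where
  g : ℕ → ℚ
  g i = f (2 *ℕ i) + f (suc (2 *ℕ i))

Σ-upTo-δ : ∀ n {p} (f : ℕ → ℚ) → p < n → Σℚ (upTo n) (λ i → 𝟙 (i ≡ᵇ p) * f i) ≡ f p
Σ-upTo-δ (suc n) {p} f p<1+n with ℕₚ.m<1+n⇒m<n∨m≡n p<1+n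
... | inj₁ p<n = begin
  Σℚ (upTo (suc n)) (λ i → 𝟙 (i ≡ᵇ p) * f i)           ≡⟨ Σ-upTo-suc n (λ i → 𝟙 (i ≡ᵇ p) * f i) ⟩
  Σℚ (upTo n) (λ i → 𝟙 (i ≡ᵇ p) * f i) + 𝟙 (n ≡ᵇ p) * f n
    ≡⟨ cong₂ _+_ (Σ-upTo-δ n f p<n) (cong (λ b → 𝟙 b * f n) (≡ᵇ-false (ℕₚ.>⇒≢ p<n))) ⟩
  f p + 0ℚ * f n                                          ≡⟨ solve 2 (λ x y → x :+ con 0ℚ :* y := x) refl (f p) (f n) ⟩
  f p                                                     ∎
... | inj₂ refl = begin
  Σℚ (upTo (suc n)) (λ i → 𝟙 (i ≡ᵇ n) * f i)           ≡⟨ Σ-upTo-suc n (λ i → 𝟙 (i ≡ᵇ n) * f i) ⟩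
  Σℚ (upTo n) (λ i → 𝟙 (i ≡ᵇ n) * f i) + 𝟙 (n ≡ᵇ n) * f n
    ≡⟨ cong₂ _+_ (Σ-upTo-cong n below-n) (cong (λ b → 𝟙 b * f n) (≡ᵇ-true (refl {x = n}))) ⟩
  Σℚ (upTo n) (λ _ → 0ℚ) + 1ℚ * f n                      ≡⟨ cong₂ _+_ (Σ-0 (upTo n)) (ℚₚ.*-identityˡ (f n)) ⟩
  0ℚ + f n                                                ≡⟨ ℚₚ.+-identityˡ (f n) ⟩
  f n                                                     ∎
  where
  below-n : ∀ i → i < n → 𝟙 (i ≡ᵇ n) * f i ≡ 0ℚ
  below-n i i<n = trans (cong (λ b → 𝟙 b * f i) (≡ᵇ-false (ℕₚ.<⇒≢ i<n))) (ℚₚ.*-zeroˡ (f i))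

Σ-upTo-𝟙≡ᵇ : ∀ n {p} → p < n → Σℚ (upTo n) (λ i → 𝟙 (i ≡ᵇ p)) ≡ 1ℚ
Σ-upTo-𝟙≡ᵇ n {p} p<n =
  trans (Σ-cong (upTo n) (λ i → sym (ℚₚ.*-identityʳ (𝟙 (i ≡ᵇ p))))) (Σ-upTo-δ n (λ _ → 1ℚ) p<n)

Σ-upTo-haar : ∀ n {p} (F : ℕ → ℚ) → suc p < n →
  Σℚ (upTo n) (λ i → (𝟙 (i ≡ᵇ p) - 𝟙 (i ≡ᵇ suc p)) * F i) ≡ F p - F (suc p)
Σ-upTo-haar n {p} F 1+p<n = begin
  Σℚ (upTo n) (λ i → (𝟙 (i ≡ᵇ p) - 𝟙 (i ≡ᵇ suc p)) * F i)
    ≡⟨ Σ-cong (upTo n) (λ i → solve 3 (λ x y f → (x :- y) :* f := x :* f :- y :* f) refl (𝟙 (i ≡ᵇ p)) (𝟙 (i ≡ᵇ suc p)) (F i)) ⟩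
  Σℚ (upTo n) (λ i → 𝟙 (i ≡ᵇ p) * F i - 𝟙 (i ≡ᵇ suc p) * F i)
    ≡⟨ Σ-minus (upTo n) (λ i → 𝟙 (i ≡ᵇ p) * F i) (λ i → 𝟙 (i ≡ᵇ suc p) * F i) ⟩
  Σℚ (upTo n) (λ i → 𝟙 (i ≡ᵇ p) * F i) - Σℚ (upTo n) (λ i → 𝟙 (i ≡ᵇ suc p) * F i)
    ≡⟨ cong₂ _-_ (Σ-upTo-δ n F (ℕₚ.<-trans (ℕₚ.n<1+n p) 1+p<n)) (Σ-upTo-δ n F 1+p<n) ⟩
  F p - F (suc p)
    ∎

Σ-upTo-half : ∀ M s (F : ℕ → ℚ) →
  Σℚ (upTo (M +ℕ M)) (λ x → 𝟙 ((M ≤ᵇ x) xor s) * F x) ≡ Σℚ (upTo M) (λ i → F (if s then i else M +ℕ i))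
Σ-upTo-half M s F = begin
  Σℚ (upTo (M +ℕ M)) (λ x → 𝟙 ((M ≤ᵇ x) xor s) * F x)
    ≡⟨ Σ-upTo-+ M M (λ x → 𝟙 ((M ≤ᵇ x) xor s) * F x) ⟩
  Σℚ (upTo M) (λ i → 𝟙 ((M ≤ᵇ i) xor s) * F i) + Σℚ (upTo M) (λ i → 𝟙 ((M ≤ᵇ M +ℕ i) xor s) * F (M +ℕ i))
    ≡⟨ cong₂ _+_ (Σ-upTo-cong M (λ i i<M → cong (λ b → 𝟙 (b xor s) * F i) (≤ᵇ-false (ℕₚ.<⇒≱ i<M))))
                 (Σ-cong (upTo M) (λ i → cong (λ b → 𝟙 (b xor s) * F (M +ℕ i)) (≤ᵇ-true (ℕₚ.m≤m+n M i)))) ⟩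
  Σℚ (upTo M) (λ i → 𝟙 s * F i) + Σℚ (upTo M) (λ i → 𝟙 (not s) * F (M +ℕ i))
    ≡⟨ halves s ⟩
  Σℚ (upTo M) (λ i → F (if s then i else M +ℕ i))
    ∎
  where
  halves : ∀ s → Σℚ (upTo M) (λ i → 𝟙 s * F i) + Σℚ (upTo M) (λ i → 𝟙 (not s) * F (M +ℕ i))
                   ≡ Σℚ (upTo M) (λ i → F (if s then i else M +ℕ i))
  halves true = begin
    Σℚ (upTo M) (λ i → 1ℚ * F i) + Σℚ (upTo M) (λ i → 0ℚ * F (M +ℕ i))
      ≡⟨ cong₂ _+_ (Σ-cong (upTo M) (λ i → ℚₚ.*-identityˡ (F i)))
                   (trans (Σ-cong (upTo M) (λ i → ℚₚ.*-zeroˡ (F (M +ℕ i)))) (Σ-0 (upTo M))) ⟩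
    Σℚ (upTo M) F + 0ℚ  ≡⟨ ℚₚ.+-identityʳ _ ⟩
    Σℚ (upTo M) F       ∎
  halves false = begin
    Σℚ (upTo M) (λ i → 0ℚ * F i) + Σℚ (upTo M) (λ i → 1ℚ * F (M +ℕ i))
      ≡⟨ cong₂ _+_ (trans (Σ-cong (upTo M) (λ i → ℚₚ.*-zeroˡ (F i))) (Σ-0 (upTo M)))
                   (Σ-cong (upTo M) (λ i → ℚₚ.*-identityˡ (F (M +ℕ i)))) ⟩
    0ℚ + Σℚ (upTo M) (λ i → F (M +ℕ i))  ≡⟨ ℚₚ.+-identityˡ _ ⟩
    Σℚ (upTo M) (λ i → F (M +ℕ i))       ∎

Σ-upTo-odd-δ : ∀ M r {q} → q < M → Σℚ (upTo M) (λ m → 𝟙 (bit r +ℕ 2 *ℕ q ≡ᵇ suc (2 *ℕ m))) ≡ 𝟙 r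
Σ-upTo-odd-δ M true {q} q<M = begin
  Σℚ (upTo M) (λ m → 𝟙 (2 *ℕ q ≡ᵇ 2 *ℕ m))    ≡⟨ Σ-cong (upTo M) (λ m → cong 𝟙 (does-⇔ (2 *ℕ q ≟ 2 *ℕ m) (m ≟ q)
                                                    (λ e → sym (ℕₚ.*-cancelˡ-≡ q m 2 e)) (λ e → cong (2 *ℕ_) (sym e)))) ⟩
  Σℚ (upTo M) (λ m → 𝟙 (m ≡ᵇ q))              ≡⟨ Σ-upTo-𝟙≡ᵇ M q<M ⟩
  1ℚ                                           ∎
Σ-upTo-odd-δ M false {q} q<M =
  trans (Σ-cong (upTo M) (λ m → cong 𝟙 (≡ᵇ-false (ℕₚ.even≢odd q m)))) (Σ-0 (upTo M))

Σ-upTo-≤ᵇ : ∀ n {x} → x ≤ n → Σℚ (upTo n) (λ i → 𝟙 (x ≤ᵇ i)) ≡ ℕtoℚ n - ℕtoℚ x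
Σ-upTo-≤ᵇ zero    z≤n = refl
Σ-upTo-≤ᵇ (suc n) {x} x≤1+n with ℕₚ.m≤n⇒m<n∨m≡n x≤1+n
... | inj₁ (s≤s x≤n) = begin
  Σℚ (upTo (suc n)) (λ i → 𝟙 (x ≤ᵇ i))          ≡⟨ Σ-upTo-suc n (λ i → 𝟙 (x ≤ᵇ i)) ⟩
  Σℚ (upTo n) (λ i → 𝟙 (x ≤ᵇ i)) + 𝟙 (x ≤ᵇ n)  ≡⟨ cong₂ _+_ (Σ-upTo-≤ᵇ n x≤n) (cong 𝟙 (≤ᵇ-true x≤n)) ⟩
  (ℕtoℚ n - ℕtoℚ x) + 1ℚ                         ≡⟨ solve 2 (λ m y → (m :- y) :+ con 1ℚ := (con 1ℚ :+ m) :- y) refl (ℕtoℚ n) (ℕtoℚ x) ⟩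
  (1ℚ + ℕtoℚ n) - ℕtoℚ x                         ≡⟨ cong (_- ℕtoℚ x) (sym (ℕtoℚ-suc n)) ⟩
  ℕtoℚ (suc n) - ℕtoℚ x                          ∎
... | inj₂ refl = begin
  Σℚ (upTo (suc n)) (λ i → 𝟙 (suc n ≤ᵇ i))      ≡⟨ Σ-upTo-suc n (λ i → 𝟙 (suc n ≤ᵇ i)) ⟩
  Σℚ (upTo n) (λ i → 𝟙 (suc n ≤ᵇ i)) + 𝟙 (suc n ≤ᵇ n)
    ≡⟨ cong₂ _+_ (Σ-upTo-cong n (λ i i<n → cong 𝟙 (≤ᵇ-false (ℕₚ.<⇒≱ (ℕₚ.m<n⇒m<1+n i<n)))))
                 (cong 𝟙 (≤ᵇ-false (ℕₚ.<⇒≱ (ℕₚ.n<1+n n)))) ⟩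
  Σℚ (upTo n) (λ _ → 0ℚ) + 0ℚ                    ≡⟨ cong (_+ 0ℚ) (Σ-0 (upTo n)) ⟩
  0ℚ                                              ≡⟨ sym (ℚₚ.+-inverseʳ (ℕtoℚ (suc n))) ⟩
  ℕtoℚ (suc n) - ℕtoℚ (suc n)                    ∎

Σ-upTo-midpoints : ∀ n → Σℚ (upTo n) (λ i → ℕtoℚ i + ½) ≡ ½ * (ℕtoℚ n * ℕtoℚ n)
Σ-upTo-midpoints zero    = refl
Σ-upTo-midpoints (suc n) = begin
  Σℚ (upTo (suc n)) (λ i → ℕtoℚ i + ½)             ≡⟨ Σ-upTo-suc n (λ i → ℕtoℚ i + ½) ⟩
  Σℚ (upTo n) (λ i → ℕtoℚ i + ½) + (ℕtoℚ n + ½)    ≡⟨ cong (_+ (ℕtoℚ n + ½)) (Σ-upTo-midpoints n) ⟩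
  ½ * (ℕtoℚ n * ℕtoℚ n) + (ℕtoℚ n + ½)
    ≡⟨ solve 1 (λ x → con ½ :* (x :* x) :+ (x :+ con ½) := con ½ :* ((con 1ℚ :+ x) :* (con 1ℚ :+ x))) refl (ℕtoℚ n) ⟩
  ½ * ((1ℚ + ℕtoℚ n) * (1ℚ + ℕtoℚ n))              ≡⟨ cong (λ x → ½ * (x * x)) (sym (ℕtoℚ-suc n)) ⟩
  ½ * (ℕtoℚ (suc n) * ℕtoℚ (suc n))                ∎

sumOfSquares : ℚ → ℚ → ℚ
sumOfSquares x c = x * ((x - 1ℚ) * (ℕtoℚ 2 * x - 1ℚ) + ℕtoℚ 6 * c * (x - 1ℚ + c))

Σ-upTo-squares : ∀ n c → ℕtoℚ 6 * Σℚ (upTo n) (λ i → (ℕtoℚ i + c) * (ℕtoℚ i + c)) ≡ sumOfSquares (ℕtoℚ n) c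
Σ-upTo-squares zero    c = sym (ℚₚ.*-zeroˡ ((0ℚ - 1ℚ) * (ℕtoℚ 2 * 0ℚ - 1ℚ) + ℕtoℚ 6 * c * (0ℚ - 1ℚ + c)))
Σ-upTo-squares (suc n) c = begin
  ℕtoℚ 6 * Σℚ (upTo (suc n)) sq                 ≡⟨ cong (ℕtoℚ 6 *_) (Σ-upTo-suc n sq) ⟩
  ℕtoℚ 6 * (Σℚ (upTo n) sq + sq n)              ≡⟨ ℚₚ.*-distribˡ-+ (ℕtoℚ 6) (Σℚ (upTo n) sq) (sq n) ⟩
  ℕtoℚ 6 * Σℚ (upTo n) sq + ℕtoℚ 6 * sq n       ≡⟨ cong (_+ ℕtoℚ 6 * sq n) (Σ-upTo-squares n c) ⟩
  sumOfSquares (ℕtoℚ n) c + ℕtoℚ 6 * sq n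
    ≡⟨ solve 2 (λ x c → x :* ((x :- con 1ℚ) :* (con (ℕtoℚ 2) :* x :- con 1ℚ) :+ con (ℕtoℚ 6) :* c :* (x :- con 1ℚ :+ c))
                         :+ con (ℕtoℚ 6) :* ((x :+ c) :* (x :+ c))
                      := (con 1ℚ :+ x) :* (((con 1ℚ :+ x) :- con 1ℚ) :* (con (ℕtoℚ 2) :* (con 1ℚ :+ x) :- con 1ℚ)
                                           :+ con (ℕtoℚ 6) :* c :* ((con 1ℚ :+ x) :- con 1ℚ :+ c)))
             refl (ℕtoℚ n) c ⟩
  sumOfSquares (1ℚ + ℕtoℚ n) c                  ≡⟨ cong (λ x → sumOfSquares x c) (sym (ℕtoℚ-suc n)) ⟩
  sumOfSquares (ℕtoℚ (suc n)) c                 ∎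
  where
  sq : ℕ → ℚ
  sq i = (ℕtoℚ i + c) * (ℕtoℚ i + c)

Σℕ-*ˡ : {A : Set} (xs : List A) (c : ℕ) (f : A → ℕ) → Σℕ xs (λ x → c *ℕ f x) ≡ c *ℕ Σℕ xs f
Σℕ-*ˡ []       c f = sym (ℕₚ.*-zeroʳ c)
Σℕ-*ˡ (x ∷ xs) c f = trans (cong (c *ℕ f x +ℕ_) (Σℕ-*ˡ xs c f)) (sym (ℕₚ.*-distribˡ-+ c (f x) _))

Σℕ-allFinL-suc : ∀ n (f : Fin (suc n) → ℕ) → Σℕ (allFinL (suc n)) f ≡ f zero +ℕ Σℕ (allFinL n) (λ i → f (suc i))
Σℕ-allFinL-suc n f = cong (λ xs → f zero +ℕ sum xs) (sym (Listₚ.map-∘ (allFinL n)))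

pointX-suc : ∀ n (t : Fin (suc n) → Bool) → pointX (suc n) t ≡ bit (t zero) +ℕ 2 *ℕ pointX n (λ i → t (suc i))
pointX-suc n t = begin
  pointX (suc n) t
    ≡⟨ Σℕ-allFinL-suc n (λ k → bit (t k) *ℕ 2 ^ toℕ k) ⟩
  bit (t zero) *ℕ 1 +ℕ Σℕ (allFinL n) (λ i → bit (t (suc i)) *ℕ (2 *ℕ 2 ^ toℕ i))
    ≡⟨ cong₂ _+ℕ_ (ℕₚ.*-identityʳ (bit (t zero)))
                  (trans (cong sum (Listₚ.map-cong (λ i → *-2-comm (bit (t (suc i))) (2 ^ toℕ i)) (allFinL n)))
                         (Σℕ-*ˡ (allFinL n) 2 (λ i → bit (t (suc i)) *ℕ 2 ^ toℕ i))) ⟩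
  bit (t zero) +ℕ 2 *ℕ pointX n (λ i → t (suc i))
    ∎
  where
  *-2-comm : ∀ x p → x *ℕ (2 *ℕ p) ≡ 2 *ℕ (x *ℕ p)
  *-2-comm = solve-∀

pointY-suc : ∀ m (a : Fin (suc m) → Bool) (σ t : Fin (suc (suc m)) → Bool) →
  pointY (suc (suc m)) a σ t
    ≡ bit (bDigits a σ t zero) *ℕ 2 ^ suc m +ℕ pointY (suc m) (λ i → a (suc i)) (λ i → σ (suc i)) (λ i → t (suc i))
pointY-suc m a σ t = Σℕ-allFinL-suc (suc m) (λ k → bit (bDigits a σ t k) *ℕ 2 ^ (suc (suc m) ∸ suc (toℕ k)))

Σ-allBits-suc : ∀ n (F : Bool → (Fin n → Bool) → ℚ) →
  Σℚ (allBits (suc n)) (λ t → F (t zero) (λ i → t (suc i))) ≡ Σℚ (allBits n) (λ v → F false v + F true v)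
Σ-allBits-suc n F = Σ-concatMap-pair (allBits n) _ _ (λ t → F (t zero) (λ i → t (suc i)))

Σ-allBits-pointX : ∀ n (f : ℕ → ℚ) → Σℚ (allBits n) (λ t → f (pointX n t)) ≡ Σℚ (upTo (2 ^ n)) f
Σ-allBits-pointX zero    f = refl
Σ-allBits-pointX (suc n) f = begin
  Σℚ (allBits (suc n)) (λ t → f (pointX (suc n) t))
    ≡⟨ Σ-cong (allBits (suc n)) (λ t → cong f (pointX-suc n t)) ⟩
  Σℚ (allBits (suc n)) (λ t → f (bit (t zero) +ℕ 2 *ℕ pointX n (λ i → t (suc i))))
    ≡⟨ Σ-allBits-suc n (λ b v → f (bit b +ℕ 2 *ℕ pointX n v)) ⟩
  Σℚ (allBits n) (λ v → f (2 *ℕ pointX n v) + f (suc (2 *ℕ pointX n v)))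
    ≡⟨ Σ-allBits-pointX n (λ x → f (2 *ℕ x) + f (suc (2 *ℕ x))) ⟩
  Σℚ (upTo (2 ^ n)) (λ x → f (2 *ℕ x) + f (suc (2 *ℕ x)))
    ≡⟨ sym (Σ-upTo-2* (2 ^ n) f) ⟩
  Σℚ (upTo (2 ^ suc n)) f
    ∎

Σ-allBits-pointY : ∀ m a σ (f : ℕ → ℚ) → Σℚ (allBits (suc m)) (λ t → f (pointY (suc m) a σ t)) ≡ Σℚ (upTo (2 ^ suc m)) f
Σ-allBits-pointY zero a σ f = begin
  Σℚ (allBits 1) (λ t → f (pointY 1 a σ t))          ≡⟨⟩
  g (false xor σ zero) + (g (true xor σ zero) + 0ℚ)  ≡⟨ cong (g (false xor σ zero) +_) (ℚₚ.+-identityʳ _) ⟩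
  g (false xor σ zero) + g (true xor σ zero)         ≡⟨ xor-pair (σ zero) g ⟩
  g false + g true                                   ≡⟨ cong (g false +_) (sym (ℚₚ.+-identityʳ (g true))) ⟩
  Σℚ (upTo 2) f                                      ∎
  where
  g : Bool → ℚ
  g b = f (bit b *ℕ 1 +ℕ 0)
Σ-allBits-pointY (suc m) a σ f = begin
  Σℚ (allBits (suc (suc m))) (λ t → f (pointY (suc (suc m)) a σ t))
    ≡⟨ Σ-cong (allBits (suc (suc m))) (λ t → cong f (pointY-suc m a σ t)) ⟩
  Σℚ (allBits (suc (suc m))) (λ t → f (bit (bDigits a σ t zero) *ℕ P +ℕ Y′ (λ i → t (suc i))))
    ≡⟨ Σ-allBits-suc (suc m) (λ b v → f (bit ((b xor (a zero ∧ lastBit v)) xor σ zero) *ℕ P +ℕ Y′ v)) ⟩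
  Σℚ (allBits (suc m)) (λ v → f (bit ((false xor (a zero ∧ lastBit v)) xor σ zero) *ℕ P +ℕ Y′ v)
                              + f (bit ((true xor (a zero ∧ lastBit v)) xor σ zero) *ℕ P +ℕ Y′ v))
    ≡⟨ Σ-cong (allBits (suc m)) first-digit ⟩
  Σℚ (allBits (suc m)) (λ v → f (Y′ v) + f (P +ℕ Y′ v))
    ≡⟨ Σ-allBits-pointY m (λ i → a (suc i)) (λ i → σ (suc i)) (λ y → f y + f (P +ℕ y)) ⟩
  Σℚ (upTo P) (λ y → f y + f (P +ℕ y))
    ≡⟨ Σ-+ (upTo P) f (λ y → f (P +ℕ y)) ⟩
  Σℚ (upTo P) f + Σℚ (upTo P) (λ y → f (P +ℕ y))
    ≡⟨ sym (Σ-upTo-+ P P f) ⟩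
  Σℚ (upTo (P +ℕ P)) f
    ≡⟨ cong (λ k → Σℚ (upTo (P +ℕ k)) f) (sym (ℕₚ.+-identityʳ P)) ⟩
  Σℚ (upTo (2 ^ suc (suc m))) f
    ∎
  where
  P : ℕ
  P = 2 ^ suc m
  Y′ : (Fin (suc m) → Bool) → ℕ
  Y′ = pointY (suc m) (λ i → a (suc i)) (λ i → σ (suc i))
  -- The leading y-digit is t₁ xor a bit that does not depend on t₁.
  first-digit : ∀ v → f (bit ((false xor (a zero ∧ lastBit v)) xor σ zero) *ℕ P +ℕ Y′ v)
                      + f (bit ((true xor (a zero ∧ lastBit v)) xor σ zero) *ℕ P +ℕ Y′ v)
                    ≡ f (Y′ v) + f (P +ℕ Y′ v)
  first-digit v = begin
    g ((false xor c) xor σ zero) + g ((true xor c) xor σ zero)  ≡⟨ xor-pair c (λ b → g (b xor σ zero)) ⟩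
    g (false xor σ zero) + g (true xor σ zero)                  ≡⟨ xor-pair (σ zero) g ⟩
    g false + g true                                            ≡⟨ cong (λ k → f (Y′ v) + f (k +ℕ Y′ v)) (ℕₚ.+-identityʳ P) ⟩
    f (Y′ v) + f (P +ℕ Y′ v)                                    ∎
    where
    c : Bool
    c = a zero ∧ lastBit v
    g : Bool → ℚ
    g b = f (bit b *ℕ P +ℕ Y′ v)

low-digit-bound : ∀ b {x P} → x < P → bit b +ℕ 2 *ℕ x < 2 *ℕ P
low-digit-bound b {x} x<P =
  ℕₚ.≤-trans (s≤s (ℕₚ.+-monoˡ-≤ (2 *ℕ x) (bit≤1 b)))
             (ℕₚ.≤-trans (ℕₚ.≤-reflexive (sym (ℕₚ.*-suc 2 x))) (ℕₚ.*-monoʳ-≤ 2 x<P))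

high-digit-bound : ∀ b {y P} → y < P → bit b *ℕ P +ℕ y < 2 *ℕ P
high-digit-bound b {y} {P} y<P =
  subst (bit b *ℕ P +ℕ y <_) (1*P+P≡2*P P) (ℕₚ.+-mono-≤-< (ℕₚ.*-monoˡ-≤ P (bit≤1 b)) y<P)
  where
  1*P+P≡2*P : ∀ P → 1 *ℕ P +ℕ P ≡ 2 *ℕ P
  1*P+P≡2*P = solve-∀

pointX<2^ : ∀ n t → pointX n t < 2 ^ n
pointX<2^ zero    t = s≤s z≤n
pointX<2^ (suc n) t =
  subst (_< 2 ^ suc n) (sym (pointX-suc n t)) (low-digit-bound (t zero) (pointX<2^ n (λ i → t (suc i))))

pointY<2^ : ∀ m a σ t → pointY (suc m) a σ t < 2 ^ suc m
pointY<2^ zero    a σ t = high-digit-bound (bDigits a σ t zero) (s≤s z≤n)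
pointY<2^ (suc m) a σ t =
  subst (_< 2 ^ suc (suc m)) (sym (pointY-suc m a σ t))
        (high-digit-bound (bDigits a σ t zero) (pointY<2^ m (λ i → a (suc i)) (λ i → σ (suc i)) (λ i → t (suc i))))

pointY-parity : ∀ m a σ t → Σ ℕ λ q → pointY (suc m) a σ t ≡ bit (lastBit t xor lastBit σ) +ℕ 2 *ℕ q
pointY-parity zero a σ t with t zero | σ zero
... | false | false = 0 , refl
... | false | true  = 0 , refl
... | true  | false = 0 , refl
... | true  | true  = 0 , refl
pointY-parity (suc m) a σ t with pointY-parity m (λ i → a (suc i)) (λ i → σ (suc i)) (λ i → t (suc i))
... | q , Y′≡ = bit (bDigits a σ t zero) *ℕ 2 ^ m +ℕ q , (begin
  pointY (suc (suc m)) a σ t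
    ≡⟨ pointY-suc m a σ t ⟩
  bit (bDigits a σ t zero) *ℕ 2 ^ suc m +ℕ pointY (suc m) (λ i → a (suc i)) (λ i → σ (suc i)) (λ i → t (suc i))
    ≡⟨ cong (bit (bDigits a σ t zero) *ℕ 2 ^ suc m +ℕ_) Y′≡ ⟩
  bit (bDigits a σ t zero) *ℕ (2 *ℕ 2 ^ m) +ℕ (bit (lastBit t xor lastBit σ) +ℕ 2 *ℕ q)
    ≡⟨ shift-digit (bit (bDigits a σ t zero)) (2 ^ m) (bit (lastBit t xor lastBit σ)) q ⟩
  bit (lastBit t xor lastBit σ) +ℕ 2 *ℕ (bit (bDigits a σ t zero) *ℕ 2 ^ m +ℕ q)
    ∎)
  where
  shift-digit : ∀ b P r q → b *ℕ (2 *ℕ P) +ℕ (r +ℕ 2 *ℕ q) ≡ r +ℕ 2 *ℕ (b *ℕ P +ℕ q)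
  shift-digit = solve-∀

lastBit-pointX : ∀ k (t : Fin (suc k) → Bool) → lastBit t ≡ (2 ^ k ≤ᵇ pointX (suc k) t)
lastBit-pointX zero t with t zero
... | false = refl
... | true  = refl
lastBit-pointX (suc k) t = begin
  lastBit t                                                        ≡⟨ lastBit-pointX k (λ i → t (suc i)) ⟩
  (2 ^ k ≤ᵇ pointX (suc k) (λ i → t (suc i)))                      ≡⟨ ≤ᵇ-double (t zero) {2 ^ k} ⟩
  (2 ^ suc k ≤ᵇ bit (t zero) +ℕ 2 *ℕ pointX (suc k) (λ i → t (suc i))) ≡⟨ cong (2 ^ suc k ≤ᵇ_) (sym (pointX-suc (suc k) t)) ⟩
  (2 ^ suc k ≤ᵇ pointX (suc (suc k)) t)                            ∎

pointY⁻¹ : ∀ {n} → (Fin (n ∸ 1) → Bool) → (Fin n → Bool) → ℕ → List (Fin n → Bool)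
pointY⁻¹ {n} a σ y = filter (λ t → pointY n a σ t ≟ y) (allBits n)

pointY⁻¹-singleton : ∀ m a σ {y} → y < 2 ^ suc m → Σ (Fin (suc m) → Bool) λ t → pointY⁻¹ a σ y ≡ t ∷ []
pointY⁻¹-singleton m a σ {y} y<2^1+m = singleton (pointY⁻¹ a σ y) (ℕtoℚ-injective (begin
  ℕtoℚ (length (pointY⁻¹ a σ y))                   ≡⟨ ℕtoℚ-length-filter (λ t → pointY (suc m) a σ t ≟ y) (allBits (suc m)) ⟩
  Σℚ (allBits (suc m)) (λ t → 𝟙 (pointY (suc m) a σ t ≡ᵇ y)) ≡⟨ Σ-allBits-pointY m a σ (λ z → 𝟙 (z ≡ᵇ y)) ⟩
  Σℚ (upTo (2 ^ suc m)) (λ z → 𝟙 (z ≡ᵇ y))          ≡⟨ Σ-upTo-𝟙≡ᵇ (2 ^ suc m) y<2^1+m ⟩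
  1ℚ                                                ∎))
  where
  singleton : {A : Set} (xs : List A) → length xs ≡ 1 → Σ A λ x → xs ≡ x ∷ []
  singleton (x ∷ []) refl = x , refl

cube : ℚ → ℚ
cube d = d * d * d

∫square-column-step : ∀ c₀ c₁ x y d →
  ∫square (bilin (c₀ * d) 0ℚ 0ℚ (0ℚ - 1ℚ)) (x * d) (y * d) d
    - ∫square (bilin (c₁ * d) 0ℚ 0ℚ (0ℚ - 1ℚ)) (x * d) ((1ℚ + y) * d) d
  ≡ cube d * (c₀ - c₁ + d * (x + ½))
∫square-column-step = solve 5 (λ c₀ c₁ x y d →
  let cell = λ c x₀ y₀ →
        c :* (d :* d) :+ con 0ℚ :* ((x₀ :* d :+ con ½ :* (d :* d)) :* d)
        :+ con 0ℚ :* (d :* (y₀ :* d :+ con ½ :* (d :* d)))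
        :+ con (0ℚ - 1ℚ) :* ((x₀ :* d :+ con ½ :* (d :* d)) :* (y₀ :* d :+ con ½ :* (d :* d)))
  in  cell (c₀ :* d) (x :* d) (y :* d) :- cell (c₁ :* d) (x :* d) ((con 1ℚ :+ y) :* d)
      := d :* d :* d :* (c₀ :- c₁ :+ d :* (x :+ con ½))) refl

recentre : ∀ d m x → d * (ℕtoℚ 2 * m) ≡ 1ℚ →
  - (ℕtoℚ 2 * m - x) + d * (½ * ((ℕtoℚ 2 * m) * (ℕtoℚ 2 * m))) ≡ x - m
recentre d m x d2m≡1 = begin
  - (ℕtoℚ 2 * m - x) + d * (½ * ((ℕtoℚ 2 * m) * (ℕtoℚ 2 * m)))
    ≡⟨ solve 3 (λ d m x → :- (con (ℕtoℚ 2) :* m :- x) :+ d :* (con ½ :* ((con (ℕtoℚ 2) :* m) :* (con (ℕtoℚ 2) :* m)))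
                        := x :- con (ℕtoℚ 2) :* m :+ m :* (d :* (con (ℕtoℚ 2) :* m))) refl d m x ⟩
  x - ℕtoℚ 2 * m + m * (d * (ℕtoℚ 2 * m))  ≡⟨ cong (λ u → x - ℕtoℚ 2 * m + m * u) d2m≡1 ⟩
  x - ℕtoℚ 2 * m + m * 1ℚ                  ≡⟨ solve 2 (λ m x → x :- con (ℕtoℚ 2) :* m :+ m :* con 1ℚ := x :- m) refl m x ⟩
  x - m                                    ∎

shift : Bool → ℚ → ℚ
shift true  m = - m
shift false m = 0ℚ

rhs : ℚ → ℚ → Bool → ℚ
rhs d p s = third * (d * d * d * d * ipow2 4) * (p * p - ℕtoℚ 3 * p + ℕtoℚ 2 + ℕtoℚ 6 * ℕtoℚ (bit s) * p)

rhs-in-powers : ∀ n s →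
  third * ipow2 (4 *ℕ n +ℕ 4) * (pow2 (2 *ℕ n) - ℕtoℚ 3 * pow2 n + ℕtoℚ 2 + ℕtoℚ 3 * ℕtoℚ (bit s) * pow2 (n +ℕ 1))
    ≡ rhs (ipow2 n) (pow2 n) s
rhs-in-powers n s = begin
  third * ipow2 (4 *ℕ n +ℕ 4) * (pow2 (2 *ℕ n) - ℕtoℚ 3 * P + ℕtoℚ 2 + ℕtoℚ 3 * b * pow2 (n +ℕ 1))
    ≡⟨ cong₂ (λ u v → third * u * (v - ℕtoℚ 3 * P + ℕtoℚ 2 + ℕtoℚ 3 * b * pow2 (n +ℕ 1))) ipow2-4n+4 pow2-2n ⟩
  third * (D * (D * (D * (D * 1ℚ))) * ipow2 4) * (P * (P * 1ℚ) - ℕtoℚ 3 * P + ℕtoℚ 2 + ℕtoℚ 3 * b * pow2 (n +ℕ 1))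
    ≡⟨ cong (λ w → third * (D * (D * (D * (D * 1ℚ))) * ipow2 4) * (P * (P * 1ℚ) - ℕtoℚ 3 * P + ℕtoℚ 2 + ℕtoℚ 3 * b * w))
            (pow2-+ n 1) ⟩
  third * (D * (D * (D * (D * 1ℚ))) * ipow2 4) * (P * (P * 1ℚ) - ℕtoℚ 3 * P + ℕtoℚ 2 + ℕtoℚ 3 * b * (P * pow2 1))
    ≡⟨ solve 3 (λ d p b →
         con third :* (d :* (d :* (d :* (d :* con 1ℚ))) :* con (ipow2 4))
           :* (p :* (p :* con 1ℚ) :- con (ℕtoℚ 3) :* p :+ con (ℕtoℚ 2) :+ con (ℕtoℚ 3) :* b :* (p :* con (pow2 1)))
         := con third :* (d :* d :* d :* d :* con (ipow2 4))
              :* (p :* p :- con (ℕtoℚ 3) :* p :+ con (ℕtoℚ 2) :+ con (ℕtoℚ 6) :* b :* p)) refl D P b ⟩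
  rhs D P s
    ∎
  where
  D P b : ℚ
  D = ipow2 n
  P = pow2 n
  b = ℕtoℚ (bit s)
  ipow2-4n+4 : ipow2 (4 *ℕ n +ℕ 4) ≡ D * (D * (D * (D * 1ℚ))) * ipow2 4
  ipow2-4n+4 = trans (ipow2-+ (4 *ℕ n) 4)
    (cong (_* ipow2 4) (trans (ipow2-+ n _) (cong (D *_) (trans (ipow2-+ n _)
      (cong (D *_) (trans (ipow2-+ n _) (cong (D *_) (ipow2-+ n 0))))))))
  pow2-2n : pow2 (2 *ℕ n) ≡ P * (P * 1ℚ)
  pow2-2n = trans (pow2-+ n _) (cong (P *_) (pow2-+ n 0))

-- Multiplying by (d * 2m)², which is 1 in the application, makes this a polynomial identity.
rhs-polynomial : ∀ s m d → m * (cube d * cube d) * (third * ½) * sumOfSquares m (shift s m)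
                             ≡ rhs d (ℕtoℚ 2 * m) s * ((d * (ℕtoℚ 2 * m)) * (d * (ℕtoℚ 2 * m)))
rhs-polynomial true = solve 2 (λ m d →
  let P = con (ℕtoℚ 2) :* m ; c = :- m in
  m :* (d :* d :* d :* (d :* d :* d)) :* (con third :* con ½)
    :* (m :* ((m :- con 1ℚ) :* (con (ℕtoℚ 2) :* m :- con 1ℚ) :+ con (ℕtoℚ 6) :* c :* (m :- con 1ℚ :+ c)))
  := con third :* (d :* d :* d :* d :* con (ipow2 4))
       :* (P :* P :- con (ℕtoℚ 3) :* P :+ con (ℕtoℚ 2) :+ con (ℕtoℚ 6) :* con (ℕtoℚ 1) :* P)
       :* ((d :* P) :* (d :* P))) refl
rhs-polynomial false = solve 2 (λ m d →
  let P = con (ℕtoℚ 2) :* m ; c = con 0ℚ in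
  m :* (d :* d :* d :* (d :* d :* d)) :* (con third :* con ½)
    :* (m :* ((m :- con 1ℚ) :* (con (ℕtoℚ 2) :* m :- con 1ℚ) :+ con (ℕtoℚ 6) :* c :* (m :- con 1ℚ :+ c)))
  := con third :* (d :* d :* d :* d :* con (ipow2 4))
       :* (P :* P :- con (ℕtoℚ 3) :* P :+ con (ℕtoℚ 2) :+ con (ℕtoℚ 6) :* con (ℕtoℚ 0) :* P)
       :* ((d :* P) :* (d :* P))) refl

closed-form : ∀ k s W → ℕtoℚ 6 * W ≡ sumOfSquares (pow2 k) (shift s (pow2 k)) →
  pow2 k * ((cube (ipow2 (suc k)) * cube (ipow2 (suc k))) * W)
    ≡ third * ipow2 (4 *ℕ suc k +ℕ 4)
        * (pow2 (2 *ℕ suc k) - ℕtoℚ 3 * pow2 (suc k) + ℕtoℚ 2 + ℕtoℚ 3 * ℕtoℚ (bit s) * pow2 (suc k +ℕ 1))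
closed-form k s W 6W≡ = begin
  m * ((cube D * cube D) * W)
    ≡⟨ solve 3 (λ m d w → m :* ((d :* d :* d :* (d :* d :* d)) :* w)
                        := m :* (d :* d :* d :* (d :* d :* d)) :* (con third :* con ½) :* (con (ℕtoℚ 6) :* w)) refl m D W ⟩
  m * (cube D * cube D) * (third * ½) * (ℕtoℚ 6 * W)                ≡⟨ cong (m * (cube D * cube D) * (third * ½) *_) 6W≡ ⟩
  m * (cube D * cube D) * (third * ½) * sumOfSquares m (shift s m)  ≡⟨ rhs-polynomial s m D ⟩
  rhs D P s * ((D * P) * (D * P))                                   ≡⟨ cong (λ u → rhs D P s * (u * u)) (ipow2*pow2 (suc k)) ⟩
  rhs D P s * 1ℚ                                                    ≡⟨ ℚₚ.*-identityʳ (rhs D P s) ⟩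
  rhs D P s                                                         ≡⟨ sym (rhs-in-powers (suc k) s) ⟩
  third * ipow2 (4 *ℕ suc k +ℕ 4)
    * (pow2 (2 *ℕ suc k) - ℕtoℚ 3 * P + ℕtoℚ 2 + ℕtoℚ 3 * ℕtoℚ (bit s) * pow2 (suc k +ℕ 1))
    ∎
  where
  m D P : ℚ
  m = pow2 k
  D = ipow2 (suc k)
  P = pow2 (suc k)

module HaarColumn (k : ℕ) (a : Fin k → Bool) (σ : Fin (suc k) → Bool) where

  n N M : ℕ
  n = suc k
  N = 2 ^ n
  M = 2 ^ k

  D : ℚ
  D = ipow2 n

  X Y : (Fin n → Bool) → ℕ
  X = pointX n
  Y = pointY n a σ

  μₘ : ℕ → ℚ
  μₘ m = μ n a σ lvm1 (lvl k) 0 m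

  count : ℕ → ℕ → ℚ
  count i₁ i₂ = Σℚ (allBits n) (λ t → 𝟙 (Y t ≤ᵇ i₂) * 𝟙 (X t ≤ᵇ i₁))

  cellIntegral : ℕ → ℕ → ℚ
  cellIntegral i₁ i₂ = ∫square (bilin (count i₁ i₂ * D) 0ℚ 0ℚ (0ℚ - 1ℚ)) (ℕtoℚ i₁ * D) (ℕtoℚ i₂ * D) D

  centred : ℕ → ℚ
  centred x = cube D * (ℕtoℚ x - pow2 k)

  μ-finest : ∀ m → μₘ m ≡ Σℚ (upTo N) λ i₁ → Σℚ (upTo N) λ i₂ →
    haarCell lvm1 0 n i₁ * haarCell (lvl k) m n i₂ * ∫square (ΔCell n a σ n i₁ i₂) (ℕtoℚ i₁ * D) (ℕtoℚ i₂ * D) D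
  μ-finest m = cong (λ L → Σℚ (upTo (2 ^ L)) λ i₁ → Σℚ (upTo (2 ^ L)) λ i₂ →
      haarCell lvm1 0 L i₁ * haarCell (lvl k) m L i₂ * ∫square (ΔCell n a σ L i₁ i₂) (ℕtoℚ i₁ * ipow2 L) (ℕtoℚ i₂ * ipow2 L) (ipow2 L))
    (cong suc (ℕₚ.⊔-idem k))

  haarCell-finest : ∀ m i → haarCell (lvl k) m n i ≡ 𝟙 (i ≡ᵇ 2 *ℕ m) - 𝟙 (i ≡ᵇ suc (2 *ℕ m))
  haarCell-finest m i =
    trans (cong (λ q → if q ≡ᵇ 2 *ℕ m then 1ℚ else if q ≡ᵇ suc (2 *ℕ m) then 0ℚ - 1ℚ else 0ℚ) (quotient (k ∸ k) (ℕₚ.n∸n≡0 k)))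
          (if-haar i (2 *ℕ m))
    where
    quotient : ∀ e → e ≡ 0 → _div_ i (2 ^ e) {{ℕₚ.m^n≢0 2 e}} ≡ i
    quotient .0 refl = n/1≡n i

  count-finest : ∀ i₁ i₂ → ℕtoℚ (countCell n a σ n i₁ i₂) ≡ count i₁ i₂
  count-finest i₁ i₂ = begin
    ℕtoℚ (countCell n a σ n i₁ i₂)
      ≡⟨ ℕtoℚ-length-filter (λ t → X t *ℕ 2 ^ (n ∸ n) ≤? i₁) (filter (λ t → Y t *ℕ 2 ^ (n ∸ n) ≤? i₂) (allBits n)) ⟩
    Σℚ (filter (λ t → Y t *ℕ 2 ^ (n ∸ n) ≤? i₂) (allBits n)) (λ t → 𝟙 (X t *ℕ 2 ^ (n ∸ n) ≤ᵇ i₁))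
      ≡⟨ Σ-filter (λ t → Y t *ℕ 2 ^ (n ∸ n) ≤? i₂) (allBits n) (λ t → 𝟙 (X t *ℕ 2 ^ (n ∸ n) ≤ᵇ i₁)) ⟩
    Σℚ (allBits n) (λ t → 𝟙 (Y t *ℕ 2 ^ (n ∸ n) ≤ᵇ i₂) * 𝟙 (X t *ℕ 2 ^ (n ∸ n) ≤ᵇ i₁))
      ≡⟨ Σ-cong (allBits n) (λ t → cong₂ (λ y x → 𝟙 (y ≤ᵇ i₂) * 𝟙 (x ≤ᵇ i₁)) (unscaled (Y t)) (unscaled (X t))) ⟩
    count i₁ i₂
      ∎
    where
    unscaled : ∀ x → x *ℕ 2 ^ (n ∸ n) ≡ x
    unscaled x = trans (cong (λ e → x *ℕ 2 ^ e) (ℕₚ.n∸n≡0 n)) (ℕₚ.*-identityʳ x)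

  μ-cells : ∀ m → μₘ m ≡ Σℚ (upTo N) λ i₁ → Σℚ (upTo N) λ i₂ →
    (𝟙 (i₂ ≡ᵇ 2 *ℕ m) - 𝟙 (i₂ ≡ᵇ suc (2 *ℕ m))) * cellIntegral i₁ i₂
  μ-cells m = trans (μ-finest m) (Σ-cong (upTo N) λ i₁ → Σ-cong (upTo N) λ i₂ →
    cong₂ _*_ (trans (ℚₚ.*-identityˡ (haarCell (lvl k) m n i₂)) (haarCell-finest m i₂))
              (cong (λ c → ∫square (bilin (c * D) 0ℚ 0ℚ (0ℚ - 1ℚ)) (ℕtoℚ i₁ * D) (ℕtoℚ i₂ * D) D) (count-finest i₁ i₂)))

  count-step : ∀ i₁ y → count i₁ y - count i₁ (suc y) ≡ - Σℚ (pointY⁻¹ a σ (suc y)) (λ t → 𝟙 (X t ≤ᵇ i₁))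
  count-step i₁ y = begin
    count i₁ y - count i₁ (suc y)
      ≡⟨ sym (Σ-minus (allBits n) (λ t → 𝟙 (Y t ≤ᵇ y) * I t) (λ t → 𝟙 (Y t ≤ᵇ suc y) * I t)) ⟩
    Σℚ (allBits n) (λ t → 𝟙 (Y t ≤ᵇ y) * I t - 𝟙 (Y t ≤ᵇ suc y) * I t)
      ≡⟨ Σ-cong (allBits n) step ⟩
    Σℚ (allBits n) (λ t → - (𝟙 (Y t ≡ᵇ suc y) * I t))
      ≡⟨ Σ-neg (allBits n) (λ t → 𝟙 (Y t ≡ᵇ suc y) * I t) ⟩
    - Σℚ (allBits n) (λ t → 𝟙 (Y t ≡ᵇ suc y) * I t)
      ≡⟨ cong -_ (sym (Σ-filter (λ t → Y t ≟ suc y) (allBits n) I)) ⟩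
    - Σℚ (pointY⁻¹ a σ (suc y)) I
      ∎
    where
    I : (Fin n → Bool) → ℚ
    I t = 𝟙 (X t ≤ᵇ i₁)
    step : ∀ t → 𝟙 (Y t ≤ᵇ y) * I t - 𝟙 (Y t ≤ᵇ suc y) * I t ≡ - (𝟙 (Y t ≡ᵇ suc y) * I t)
    step t = begin
      𝟙 (Y t ≤ᵇ y) * I t - 𝟙 (Y t ≤ᵇ suc y) * I t
        ≡⟨ solve 3 (λ u v w → u :* w :- v :* w := (u :- v) :* w) refl (𝟙 (Y t ≤ᵇ y)) (𝟙 (Y t ≤ᵇ suc y)) (I t) ⟩
      (𝟙 (Y t ≤ᵇ y) - 𝟙 (Y t ≤ᵇ suc y)) * I t  ≡⟨ cong (_* I t) (𝟙-≤ᵇ-step (Y t) y) ⟩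
      - 𝟙 (Y t ≡ᵇ suc y) * I t                  ≡⟨ sym (ℚₚ.neg-distribˡ-* (𝟙 (Y t ≡ᵇ suc y)) (I t)) ⟩
      - (𝟙 (Y t ≡ᵇ suc y) * I t)                ∎

  μ-at-pointY⁻¹ : ∀ {m t₀} → m < M → pointY⁻¹ a σ (suc (2 *ℕ m)) ≡ t₀ ∷ [] → μₘ m ≡ centred (X t₀)
  μ-at-pointY⁻¹ {m} {t₀} m<M pointY⁻¹≡t₀ = begin
    μₘ m
      ≡⟨ μ-cells m ⟩
    Σℚ (upTo N) (λ i₁ → Σℚ (upTo N) λ i₂ → (𝟙 (i₂ ≡ᵇ 2 *ℕ m) - 𝟙 (i₂ ≡ᵇ suc (2 *ℕ m))) * cellIntegral i₁ i₂)
      ≡⟨ Σ-cong (upTo N) (λ i₁ → trans (Σ-upTo-haar N (cellIntegral i₁) (low-digit-bound true m<M)) (column i₁)) ⟩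
    Σℚ (upTo N) (λ i₁ → cube D * (- 𝟙 (x₀ ≤ᵇ i₁) + D * (ℕtoℚ i₁ + ½)))
      ≡⟨ Σ-*ˡ (upTo N) (cube D) (λ i₁ → - 𝟙 (x₀ ≤ᵇ i₁) + D * (ℕtoℚ i₁ + ½)) ⟩
    cube D * Σℚ (upTo N) (λ i₁ → - 𝟙 (x₀ ≤ᵇ i₁) + D * (ℕtoℚ i₁ + ½))
      ≡⟨ cong (cube D *_) (trans (Σ-+ (upTo N) (λ i₁ → - 𝟙 (x₀ ≤ᵇ i₁)) (λ i₁ → D * (ℕtoℚ i₁ + ½)))
                                 (cong₂ _+_ (Σ-neg (upTo N) (λ i₁ → 𝟙 (x₀ ≤ᵇ i₁))) (Σ-*ˡ (upTo N) D (λ i₁ → ℕtoℚ i₁ + ½)))) ⟩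
    cube D * (- Σℚ (upTo N) (λ i₁ → 𝟙 (x₀ ≤ᵇ i₁)) + D * Σℚ (upTo N) (λ i₁ → ℕtoℚ i₁ + ½))
      ≡⟨ cong₂ (λ u v → cube D * (- u + D * v)) (Σ-upTo-≤ᵇ N (ℕₚ.<⇒≤ (pointX<2^ n t₀))) (Σ-upTo-midpoints N) ⟩
    cube D * (- (ℕtoℚ N - ℕtoℚ x₀) + D * (½ * (ℕtoℚ N * ℕtoℚ N)))
      ≡⟨ cong (λ z → cube D * (- (z - ℕtoℚ x₀) + D * (½ * (z * z)))) (sym (pow2≡ℕtoℚ n)) ⟩
    cube D * (- (pow2 n - ℕtoℚ x₀) + D * (½ * (pow2 n * pow2 n)))
      ≡⟨ cong (cube D *_) (recentre D (pow2 k) (ℕtoℚ x₀) (ipow2*pow2 n)) ⟩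
    centred x₀
      ∎
    where
    x₀ : ℕ
    x₀ = X t₀
    column : ∀ i₁ → cellIntegral i₁ (2 *ℕ m) - cellIntegral i₁ (suc (2 *ℕ m)) ≡ cube D * (- 𝟙 (x₀ ≤ᵇ i₁) + D * (ℕtoℚ i₁ + ½))
    column i₁ = begin
      cellIntegral i₁ (2 *ℕ m) - cellIntegral i₁ (suc (2 *ℕ m))
        ≡⟨ cong (λ z → cellIntegral i₁ (2 *ℕ m) - ∫square (bilin (count i₁ (suc (2 *ℕ m)) * D) 0ℚ 0ℚ (0ℚ - 1ℚ)) (ℕtoℚ i₁ * D) (z * D) D)
                (ℕtoℚ-suc (2 *ℕ m)) ⟩
      _ ≡⟨ ∫square-column-step (count i₁ (2 *ℕ m)) (count i₁ (suc (2 *ℕ m))) (ℕtoℚ i₁) (ℕtoℚ (2 *ℕ m)) D ⟩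
      cube D * (count i₁ (2 *ℕ m) - count i₁ (suc (2 *ℕ m)) + D * (ℕtoℚ i₁ + ½))
        ≡⟨ cong (λ c → cube D * (c + D * (ℕtoℚ i₁ + ½))) (count-step i₁ (2 *ℕ m)) ⟩
      cube D * (- Σℚ (pointY⁻¹ a σ (suc (2 *ℕ m))) (λ t → 𝟙 (X t ≤ᵇ i₁)) + D * (ℕtoℚ i₁ + ½))
        ≡⟨ cong (λ ts → cube D * (- Σℚ ts (λ t → 𝟙 (X t ≤ᵇ i₁)) + D * (ℕtoℚ i₁ + ½))) pointY⁻¹≡t₀ ⟩
      cube D * (- (𝟙 (x₀ ≤ᵇ i₁) + 0ℚ) + D * (ℕtoℚ i₁ + ½))
        ≡⟨ cong (λ u → cube D * (- u + D * (ℕtoℚ i₁ + ½))) (ℚₚ.+-identityʳ (𝟙 (x₀ ≤ᵇ i₁))) ⟩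
      cube D * (- 𝟙 (x₀ ≤ᵇ i₁) + D * (ℕtoℚ i₁ + ½))
        ∎

  μ²-at-pointY⁻¹ : ∀ {m} → m < M → μₘ m * μₘ m ≡ Σℚ (pointY⁻¹ a σ (suc (2 *ℕ m))) (λ t → centred (X t) * centred (X t))
  μ²-at-pointY⁻¹ {m} m<M = at (pointY⁻¹-singleton k a σ (low-digit-bound true m<M))
    where
    at : Σ (Fin n → Bool) (λ t₀ → pointY⁻¹ a σ (suc (2 *ℕ m)) ≡ t₀ ∷ []) →
         μₘ m * μₘ m ≡ Σℚ (pointY⁻¹ a σ (suc (2 *ℕ m))) (λ t → centred (X t) * centred (X t))
    at (t₀ , pointY⁻¹≡t₀) = begin
      μₘ m * μₘ m                                                ≡⟨ cong (λ z → z * z) (μ-at-pointY⁻¹ m<M pointY⁻¹≡t₀) ⟩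
      centred (X t₀) * centred (X t₀)                                        ≡⟨ sym (ℚₚ.+-identityʳ (centred (X t₀) * centred (X t₀))) ⟩
      Σℚ (t₀ ∷ []) (λ t → centred (X t) * centred (X t))                     ≡⟨ cong (λ ts → Σℚ ts (λ t → centred (X t) * centred (X t))) (sym pointY⁻¹≡t₀) ⟩
      Σℚ (pointY⁻¹ a σ (suc (2 *ℕ m))) (λ t → centred (X t) * centred (X t)) ∎

  pointY-odd : ∀ t → Σℚ (upTo M) (λ m → 𝟙 (Y t ≡ᵇ suc (2 *ℕ m))) ≡ 𝟙 (lastBit t xor lastBit σ)
  pointY-odd t with pointY-parity k a σ t
  ... | q , Y≡r+2q =
    trans (Σ-cong (upTo M) (λ m → cong (λ y → 𝟙 (y ≡ᵇ suc (2 *ℕ m))) Y≡r+2q)) (Σ-upTo-odd-δ M r q<M)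
    where
    r : Bool
    r = lastBit t xor lastBit σ
    q<M : q < M
    q<M = ℕₚ.*-cancelˡ-< 2 q M (ℕₚ.≤-<-trans (ℕₚ.m≤n+m (2 *ℕ q) (bit r)) (subst (_< N) Y≡r+2q (pointY<2^ k a σ t)))

  Σ-squared-μ-by-x : Σℚ (upTo M) (λ m → ∣ μₘ m ∣ * ∣ μₘ m ∣)
    ≡ Σℚ (upTo N) (λ x → 𝟙 ((M ≤ᵇ x) xor lastBit σ) * (centred x * centred x))
  Σ-squared-μ-by-x = begin
    Σℚ (upTo M) (λ m → ∣ μₘ m ∣ * ∣ μₘ m ∣)
      ≡⟨ Σ-cong (upTo M) (λ m → ∣p∣*∣p∣≡p*p (μₘ m)) ⟩
    Σℚ (upTo M) (λ m → μₘ m * μₘ m)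
      ≡⟨ Σ-upTo-cong M (λ m m<M → μ²-at-pointY⁻¹ m<M) ⟩
    Σℚ (upTo M) (λ m → Σℚ (pointY⁻¹ a σ (suc (2 *ℕ m))) centred²)
      ≡⟨ Σ-cong (upTo M) (λ m → Σ-filter (λ t → Y t ≟ suc (2 *ℕ m)) (allBits n) centred²) ⟩
    Σℚ (upTo M) (λ m → Σℚ (allBits n) (λ t → 𝟙 (Y t ≡ᵇ suc (2 *ℕ m)) * centred² t))
      ≡⟨ Σ-swap (upTo M) (allBits n) (λ m t → 𝟙 (Y t ≡ᵇ suc (2 *ℕ m)) * centred² t) ⟩
    Σℚ (allBits n) (λ t → Σℚ (upTo M) (λ m → 𝟙 (Y t ≡ᵇ suc (2 *ℕ m)) * centred² t))
      ≡⟨ Σ-cong (allBits n) (λ t → trans (Σ-*ʳ (upTo M) (λ m → 𝟙 (Y t ≡ᵇ suc (2 *ℕ m))) (centred² t)) (cong (_* centred² t) (pointY-odd t))) ⟩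
    Σℚ (allBits n) (λ t → 𝟙 (lastBit t xor lastBit σ) * centred² t)
      ≡⟨ Σ-cong (allBits n) (λ t → cong (λ b → 𝟙 (b xor lastBit σ) * centred² t) (lastBit-pointX k t)) ⟩
    Σℚ (allBits n) (λ t → 𝟙 ((M ≤ᵇ X t) xor lastBit σ) * (centred (X t) * centred (X t)))
      ≡⟨ Σ-allBits-pointX n (λ x → 𝟙 ((M ≤ᵇ x) xor lastBit σ) * (centred x * centred x)) ⟩
    Σℚ (upTo N) (λ x → 𝟙 ((M ≤ᵇ x) xor lastBit σ) * (centred x * centred x))
      ∎
    where
    centred² : (Fin n → Bool) → ℚ
    centred² t = centred (X t) * centred (X t)

  Σ-squared-μ : Σℚ (upTo M) (λ m → ∣ μₘ m ∣ * ∣ μₘ m ∣)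
    ≡ (cube D * cube D) * Σℚ (upTo M) (λ i → (ℕtoℚ i + shift (lastBit σ) (pow2 k)) * (ℕtoℚ i + shift (lastBit σ) (pow2 k)))
  Σ-squared-μ = begin
    Σℚ (upTo M) (λ m → ∣ μₘ m ∣ * ∣ μₘ m ∣)
      ≡⟨ Σ-squared-μ-by-x ⟩
    Σℚ (upTo N) (λ x → 𝟙 ((M ≤ᵇ x) xor lastBit σ) * (centred x * centred x))
      ≡⟨ cong (λ K → Σℚ (upTo (M +ℕ K)) (λ x → 𝟙 ((M ≤ᵇ x) xor lastBit σ) * (centred x * centred x))) (ℕₚ.+-identityʳ M) ⟩
    Σℚ (upTo (M +ℕ M)) (λ x → 𝟙 ((M ≤ᵇ x) xor lastBit σ) * (centred x * centred x))
      ≡⟨ Σ-upTo-half M (lastBit σ) (λ x → centred x * centred x) ⟩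
    Σℚ (upTo M) (λ i → centred (half (lastBit σ) i) * centred (half (lastBit σ) i))
      ≡⟨ Σ-cong (upTo M) (centred²-half (lastBit σ)) ⟩
    Σℚ (upTo M) (λ i → (cube D * cube D) * ((ℕtoℚ i + shift (lastBit σ) (pow2 k)) * (ℕtoℚ i + shift (lastBit σ) (pow2 k))))
      ≡⟨ Σ-*ˡ (upTo M) (cube D * cube D) (λ i → (ℕtoℚ i + shift (lastBit σ) (pow2 k)) * (ℕtoℚ i + shift (lastBit σ) (pow2 k))) ⟩
    (cube D * cube D) * Σℚ (upTo M) (λ i → (ℕtoℚ i + shift (lastBit σ) (pow2 k)) * (ℕtoℚ i + shift (lastBit σ) (pow2 k)))
      ∎
    where
    half : Bool → ℕ → ℕ
    half s i = if s then i else M +ℕ i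
    centred²-half : ∀ s i → centred (half s i) * centred (half s i) ≡ (cube D * cube D) * ((ℕtoℚ i + shift s (pow2 k)) * (ℕtoℚ i + shift s (pow2 k)))
    centred²-half true  i = solve 3 (λ d x m → (d :* d :* d :* (x :- m)) :* (d :* d :* d :* (x :- m))
                                       := (d :* d :* d :* (d :* d :* d)) :* ((x :+ :- m) :* (x :+ :- m))) refl D (ℕtoℚ i) (pow2 k)
    centred²-half false i = begin
      centred (M +ℕ i) * centred (M +ℕ i)
        ≡⟨ cong (λ z → (cube D * (z - pow2 k)) * (cube D * (z - pow2 k))) (trans (ℕtoℚ-+ M i) (cong (_+ ℕtoℚ i) (sym (pow2≡ℕtoℚ k)))) ⟩
      (cube D * (pow2 k + ℕtoℚ i - pow2 k)) * (cube D * (pow2 k + ℕtoℚ i - pow2 k))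
        ≡⟨ solve 3 (λ d x m → (d :* d :* d :* (m :+ x :- m)) :* (d :* d :* d :* (m :+ x :- m))
                             := (d :* d :* d :* (d :* d :* d)) :* ((x :+ con 0ℚ) :* (x :+ con 0ℚ))) refl D (ℕtoℚ i) (pow2 k) ⟩
      (cube D * cube D) * ((ℕtoℚ i + 0ℚ) * (ℕtoℚ i + 0ℚ))
        ∎

lemma3 : (n : ℕ) → 2 ≤ n → (a : Fin (n ∸ 1) → Bool) → (σ : Fin n → Bool) →
    pow2 (n ∸ 1) * Σℚ (upTo (pow2ℕ (n ∸ 1)))
        (λ m2 → ∣ μ n a σ lvm1 (lvl (n ∸ 1)) 0 m2 ∣ * ∣ μ n a σ lvm1 (lvl (n ∸ 1)) 0 m2 ∣)
      ≡ third * ipow2 (4 *ℕ n +ℕ 4)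
          * (pow2 (2 *ℕ n) - ℕtoℚ 3 * pow2 n + ℕtoℚ 2
             + ℕtoℚ 3 * ℕtoℚ (bit (lastBit σ)) * pow2 (n +ℕ 1))
-- The argument works for every n ≥ 1; the hypothesis 2 ≤ n only rules out n = 0.
lemma3 (suc k) _ a σ =
  trans (cong (pow2 k *_) (HaarColumn.Σ-squared-μ k a σ))
        (closed-form k (lastBit σ) _ (trans (Σ-upTo-squares (2 ^ k) c) (cong (λ x → sumOfSquares x c) (sym (pow2≡ℕtoℚ k)))))
  where
  c : ℚ
  c = shift (lastBit σ) (pow2 k)
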